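{- Let $G$ be a bipartite graph with sides $B,C$ and let $s\ge1$ be a real number. Let $f:E(G)\to\mathbb{Z}$ satisfy: $f(e)\in\{0,1,2\}$ for all $e\in E(G)$; $\deg_f(b)\le 2s$ for all $b\in B$; $\deg_f(c)\le 2$ for all $c\in C$. Then $$\eta(\mathcal{M}(G))\ge\left\lceil\frac{|f|}{2s+2}\right\rceil,$$ where $|f|=\sum_{e\in E(G)}f(e)$.
   Context: $\deg_f(v)=\sum_{e\ni v}f(e)$. $\mathcal{M}(G)$ is the matching complex of $G$: the simplicial complex with vertex set $E(G)$ whose faces are the matchings of $G$. For a simplicial complex $\mathcal{C}$, its homological connectivity $\eta(\mathcal{C})$ is the largest $k$ such that the reduced simplicial homology groups $\tilde H_j(\mathcal{C};\mathbb{Q})$ vanish for all $-1\le j\le k$, plus $2$ (and $\eta(\mathcal{C})=\infty$ if they all vanish).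
   Formalization: The parameter $s\ge1$ ranges over the rationals instead of the reals. -}

module Defs where

open import Data.Nat as ℕ using (ℕ; zero; suc)
open import Data.Integer as ℤ using (ℤ; +_)
open import Data.Rational as ℚ using (ℚ; 0ℚ; 1ℚ)
import Data.Rational.Properties as ℚP
open import Data.Fin using (Fin; _<_; _<?_)
open import Data.Fin.Subset using (Subset; _∈_; ⁅_⁆; _∪_; ∣_∣)
open import Data.Fin.Subset.Properties using (_∈?_)
open import Data.List using (List; length; lookup)
open import Data.Product using (_×_; _,_; proj₁; proj₂; Σ-syntax)
open import Data.Bool using (if_then_else_)
open import Relation.Binary.PropositionalEquality using (_≡_; _≢_)
open import Relation.Nullary using (yes; no; Dec)
open import Relation.Nullary.Decidable using (does)

Σℚ : (m : ℕ) → (Fin m → ℚ) → ℚ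
Σℚ zero    g = 0ℚ
Σℚ (suc m) g = g Fin.zero ℚ.+ Σℚ m (λ i → g (Fin.suc i))
  where import Data.Fin as Fin

Σℕ : (m : ℕ) → (Fin m → ℕ) → ℕ
Σℕ zero    g = 0
Σℕ (suc m) g = g Fin.zero ℕ.+ Σℕ m (λ i → g (Fin.suc i))
  where import Data.Fin as Fin

ℕ→ℚ : ℕ → ℚ
ℕ→ℚ n = (+ n) ℚ./ 1

-- Reduced simplicial homology over ℚ of a simplicial complex on the
-- ordered vertex set Fin m, whose faces are the subsets satisfying Face.
--
-- A face σ with |σ| = d is a (d-1)-simplex; we index chain groups by the
-- face size d, so d = j + 1 where j is the homological degree (d = 0 is
-- the empty face, i.e. the augmentation degree j = -1).

IsChain : {m : ℕ} (Face : Subset m → Set) (d : ℕ) (c : Subset m → ℚ) → Set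
IsChain Face d c = ∀ σ → c σ ≢ 0ℚ → Face σ × ∣ σ ∣ ≡ d

count< : {m : ℕ} → Fin m → Subset m → ℕ
count< {m} i σ = Σℕ m (λ j → if does (j ∈? σ) then (if does (j <? i) then 1 else 0) else 0)

sign : ℕ → ℚ
sign zero          = 1ℚ
sign (suc zero)    = ℚ.- 1ℚ
sign (suc (suc k)) = sign k

∂ : {m : ℕ} → (Subset m → ℚ) → Subset m → ℚ
∂ {m} c σ = Σℚ m (λ i → if does (i ∈? σ) then 0ℚ
                         else sign (count< i σ) ℚ.* c (σ ∪ ⁅ i ⁆))

HomologyVanishes : {m : ℕ} (Face : Subset m → Set) (d : ℕ) → Set
HomologyVanishes Face d =
  ∀ c → IsChain Face d c → (∀ σ → ∂ c σ ≡ 0ℚ) →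
  Σ[ w ∈ (Subset _ → ℚ) ] (IsChain Face (suc d) w × (∀ σ → ∂ w σ ≡ c σ))

-- η(𝒞) ≥ k  :⟺  H̃_j(𝒞;ℚ) = 0 for all -1 ≤ j ≤ k - 2,
-- i.e. for all face sizes d = j + 1 with 0 ≤ d ≤ k - 1.
η≥ : {m : ℕ} (Face : Subset m → Set) (k : ℤ) → Set
η≥ Face k = ∀ (d : ℕ) → (+ d) ℤ.≤ k ℤ.- ℤ.1ℤ → HomologyVanishes Face d

-- Bipartite graphs with sides B = Fin p, C = Fin q, edge list es
-- (edges of G are indexed by Fin (length es)).

edge : {p q : ℕ} (es : List (Fin p × Fin q)) → Fin (length es) → Fin p × Fin q
edge es i = lookup es i

IsMatching : {p q : ℕ} (es : List (Fin p × Fin q)) → Subset (length es) → Set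
IsMatching es σ = ∀ i j → i ∈ σ → j ∈ σ → i ≢ j →
  (proj₁ (edge es i) ≢ proj₁ (edge es j)) × (proj₂ (edge es i) ≢ proj₂ (edge es j))

degB : {p q : ℕ} (es : List (Fin p × Fin q)) → (Fin (length es) → ℕ) → Fin p → ℕ
degB {p} es f b = Σℕ (length es) (λ i → if does (proj₁ (edge es i) Data.Fin.≟ b) then f i else 0)
  where import Data.Fin

degC : {p q : ℕ} (es : List (Fin p × Fin q)) → (Fin (length es) → ℕ) → Fin q → ℕ
degC {p} es f c = Σℕ (length es) (λ i → if does (proj₂ (edge es i) Data.Fin.≟ c) then f i else 0)
  where import Data.Fin

∣_∣f : {m : ℕ} → (Fin m → ℕ) → ℕ
∣_∣f {m} f = Σℕ m f

2ℚ : ℚ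
2ℚ = (+ 2) ℚ./ 1

private
  pos-s : (s : ℚ) → 1ℚ ℚ.≤ s → ℚ.Positive s
  pos-s s h = ℚ.positive (ℚP.<-≤-trans (ℚP.positive⁻¹ 1ℚ) h)

  2s+2-nz : (s : ℚ) → 1ℚ ℚ.≤ s → ℚ.NonZero (2ℚ ℚ.* s ℚ.+ 2ℚ)
  2s+2-nz s h = ℚP.pos⇒nonZero (2ℚ ℚ.* s ℚ.+ 2ℚ)
    {{ ℚP.pos+pos⇒pos (2ℚ ℚ.* s) {{ ℚP.pos*pos⇒pos 2ℚ s {{ pos-s s h }} }} 2ℚ }}

ceilDiv : (a : ℕ) (s : ℚ) → 1ℚ ℚ.≤ s → ℤ
ceilDiv a s h = ℚ.⌈ (ℚ._÷_ (ℕ→ℚ a) (2ℚ ℚ.* s ℚ.+ 2ℚ) {{ 2s+2-nz s h }}) ⌉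

module Submission where

-- A vertex v of a complex that can be added to every face avoiding it makes the complex a cone,
-- which is acyclic. If instead faces stay faces when v is removed, a cycle z splits as its part
-- avoiding v plus the cone over its link part y, and the first part has boundary −y; so z bounds
-- as soon as the deletion of v is acyclic in the degree of z and the link of v one degree lower.
--
-- For the matching complex of an edge set A, the deletion of an edge e is M(A − e) and its link
-- is M(A − N(e)), where N(e) are the edges meeting e. Weighting A by f, passing to the link loses
-- at most f(e) + deg_f(b) + deg_f(c) ≤ 2s + 2 and deleting an edge of weight 0 loses nothing, so
-- by induction on A, M(A) is acyclic below n whenever (n − 1)(2s + 2) < f(A). When all weights
-- are positive, either some edge e is alone at its C-end, and deleting the other edges at its
-- B-end (whose links are cheap) leaves e isolated, a cone point; or two edges share a C-end, both
-- of weight 1, and deleting one of them costs 1 and leaves the other alone at its C-end.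

open import Defs
open import Level using (0ℓ)
open import Algebra.Bundles using (CommutativeMonoid)
import Algebra.Properties.CommutativeSemigroup as CommutativeSemigroupProperties
import Algebra.Properties.Group as GroupProperties
open import Data.Nat as ℕ using (ℕ; zero; suc; _≤_; _<_; z≤n)
import Data.Nat.Properties as ℕP
import Data.Nat.Coprimality as Coprime
open import Data.Integer as ℤ using (ℤ)
import Data.Integer.Properties as ℤP
import Data.Integer.DivMod as ℤD
import Data.Integer.Tactic.RingSolver as ℤ-Solver
open import Data.Rational as ℚ using (ℚ; mkℚ; 0ℚ; 1ℚ; _+_; _*_; -_)
import Data.Rational.Properties as ℚP
open import Data.Fin as Fin using (Fin; zero; suc; _<?_)
open import Data.Fin.Properties using (_≟_; toℕ-injective; suc-injective; any?)
open import Data.Fin.Subset using (Subset; _∈_; _∉_; _⊆_; ⁅_⁆; _∪_; _─_; _-_; ∣_∣; ⊤; inside; outside)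
open import Data.Fin.Subset.Properties
  using (_∈?_; ⊆-antisym; x∈p∪q⁺; x∈p∪q⁻; x∈⁅x⁆; x∈⁅y⁆⇒x≡y; x∈p∧x≢y⇒x∈p-y; x∈p∧x∉q⇒x∈p─q;
         p─q⊆p; p⊆p∪q; ∪-identityʳ; drop-there; p⊆q⇒∣p∣≤∣q∣; x∈p⇒∣p-x∣<∣p∣; ∈⊤; ∣p∣≤n)
open import Data.Vec using (_∷_; here; there; tabulate)
import Data.Vec.Properties as Vec
open import Data.Bool using (Bool; true; false; if_then_else_)
open import Data.List using (List; length)
open import Data.List.Relation.Unary.Unique.Propositional using (Unique)
open import Data.Product using (_×_; _,_; proj₁; proj₂; Σ-syntax)
import Data.Product as Product
open import Data.Sum using (_⊎_; inj₁; inj₂; [_,_]′)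
import Data.Sum as Sum
open import Data.Empty using (⊥-elim)
open import Function using (_∘_; id; _⇔_; mk⇔; Equivalence)
open import Relation.Nullary using (yes; no; Dec; ¬_)
open import Relation.Nullary.Decidable using (does; dec-true; dec-false; dec⇒maybe; _⊎-dec_; _×-dec_; ¬?)
open import Relation.Binary.PropositionalEquality
open import Tactic.RingSolver using (solve-∀)
open import Tactic.RingSolver.Core.AlmostCommutativeRing using (AlmostCommutativeRing; fromCommutativeRing)

open ≡-Reasoning

ℚ-ring : AlmostCommutativeRing 0ℓ 0ℓ
ℚ-ring = fromCommutativeRing ℚP.+-*-commutativeRing (dec⇒maybe ∘ (0ℚ ℚP.≟_))

open CommutativeSemigroupProperties (CommutativeMonoid.commutativeSemigroup ℚP.+-0-commutativeMonoid)
  using () renaming (interchange to ℚ-+-interchange)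
open CommutativeSemigroupProperties ℕP.+-commutativeSemigroup
  using () renaming (interchange to ℕ-+-interchange; x∙yz≈y∙xz to ℕ-+-left-comm)
open GroupProperties ℚP.+-0-group
  using () renaming (⁻¹-involutive to ℚ-neg-involutive; inverseˡ-unique to ℚ-+≡0⇒≡neg)

ℚ-neg≡0⇒≡0 : ∀ {x} → - x ≡ 0ℚ → x ≡ 0ℚ
ℚ-neg≡0⇒≡0 {x} neg≡0 = trans (sym (ℚ-neg-involutive x)) (cong -_ neg≡0)

module _ {a p} {A : Set a} {P : Set p} {x y : A} where

  if-yes : (P? : Dec P) → P → (if does P? then x else y) ≡ x
  if-yes P? p = cong (λ b → if b then x else y) (dec-true P? p)

  if-no : (P? : Dec P) → ¬ P → (if does P? then x else y) ≡ y
  if-no P? ¬p = cong (λ b → if b then x else y) (dec-false P? ¬p)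

Σℚ-cong : ∀ m {g h : Fin m → ℚ} → (∀ i → g i ≡ h i) → Σℚ m g ≡ Σℚ m h
Σℚ-cong zero    g≗h = refl
Σℚ-cong (suc m) g≗h = cong₂ _+_ (g≗h zero) (Σℚ-cong m (g≗h ∘ suc))

Σℚ-zero : ∀ m {g : Fin m → ℚ} → (∀ i → g i ≡ 0ℚ) → Σℚ m g ≡ 0ℚ
Σℚ-zero zero    g≗0 = refl
Σℚ-zero (suc m) g≗0 = cong₂ _+_ (g≗0 zero) (Σℚ-zero m (g≗0 ∘ suc))

Σℚ-+ : ∀ m (g h : Fin m → ℚ) → Σℚ m (λ i → g i + h i) ≡ Σℚ m g + Σℚ m h
Σℚ-+ zero    g h = refl
Σℚ-+ (suc m) g h = trans (cong (g zero + h zero +_) (Σℚ-+ m (g ∘ suc) (h ∘ suc)))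
                         (ℚ-+-interchange (g zero) (h zero) _ _)

Σℚ-*ˡ : ∀ m (a : ℚ) (g : Fin m → ℚ) → Σℚ m (λ i → a * g i) ≡ a * Σℚ m g
Σℚ-*ˡ zero    a g = sym (ℚP.*-zeroʳ a)
Σℚ-*ˡ (suc m) a g = trans (cong (a * g zero +_) (Σℚ-*ˡ m a (g ∘ suc))) (sym (ℚP.*-distribˡ-+ a _ _))

Σℚ-neg : ∀ m (g : Fin m → ℚ) → Σℚ m (λ i → - g i) ≡ - Σℚ m g
Σℚ-neg zero    g = refl
Σℚ-neg (suc m) g = trans (cong (- g zero +_) (Σℚ-neg m (g ∘ suc))) (sym (ℚP.neg-distrib-+ (g zero) _))

Σℚ-single : ∀ m (g : Fin m → ℚ) v → (∀ i → i ≢ v → g i ≡ 0ℚ) → Σℚ m g ≡ g v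
Σℚ-single (suc m) g zero    g≗0 =
  trans (cong (g zero +_) (Σℚ-zero m (λ i → g≗0 (suc i) λ ()))) (ℚP.+-identityʳ _)
Σℚ-single (suc m) g (suc v) g≗0 =
  trans (cong₂ _+_ (g≗0 zero λ ()) (Σℚ-single m (g ∘ suc) v (λ i i≢v → g≗0 (suc i) (i≢v ∘ suc-injective))))
        (ℚP.+-identityˡ _)

Σℕ-cong : ∀ m {g h : Fin m → ℕ} → (∀ i → g i ≡ h i) → Σℕ m g ≡ Σℕ m h
Σℕ-cong zero    g≗h = refl
Σℕ-cong (suc m) g≗h = cong₂ ℕ._+_ (g≗h zero) (Σℕ-cong m (g≗h ∘ suc))

Σℕ-zero : ∀ m {g : Fin m → ℕ} → (∀ i → g i ≡ 0) → Σℕ m g ≡ 0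
Σℕ-zero zero    g≗0 = refl
Σℕ-zero (suc m) g≗0 = cong₂ ℕ._+_ (g≗0 zero) (Σℕ-zero m (g≗0 ∘ suc))

Σℕ-mono-≤ : ∀ m {g h : Fin m → ℕ} → (∀ i → g i ≤ h i) → Σℕ m g ≤ Σℕ m h
Σℕ-mono-≤ zero    g≤h = z≤n
Σℕ-mono-≤ (suc m) g≤h = ℕP.+-mono-≤ (g≤h zero) (Σℕ-mono-≤ m (g≤h ∘ suc))

Σℕ-+ : ∀ m (g h : Fin m → ℕ) → Σℕ m (λ i → g i ℕ.+ h i) ≡ Σℕ m g ℕ.+ Σℕ m h
Σℕ-+ zero    g h = refl
Σℕ-+ (suc m) g h = trans (cong (g zero ℕ.+ h zero ℕ.+_) (Σℕ-+ m (g ∘ suc) (h ∘ suc)))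
                         (ℕ-+-interchange (g zero) (h zero) _ _)

Σℕ-single : ∀ m (g : Fin m → ℕ) v → (∀ i → i ≢ v → g i ≡ 0) → Σℕ m g ≡ g v
Σℕ-single (suc m) g zero    g≗0 =
  trans (cong (g zero ℕ.+_) (Σℕ-zero m (λ i → g≗0 (suc i) λ ()))) (ℕP.+-identityʳ _)
Σℕ-single (suc m) g (suc v) g≗0 =
  cong₂ ℕ._+_ (g≗0 zero λ ()) (Σℕ-single m (g ∘ suc) v (λ i i≢v → g≗0 (suc i) (i≢v ∘ suc-injective)))

erase : ∀ {m} → (Fin m → ℕ) → Fin m → Fin m → ℕ
erase g v i = if does (i ≟ v) then 0 else g i

erase-≢ : ∀ {m} (g : Fin m → ℕ) {v i} → i ≢ v → erase g v i ≡ g i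
erase-≢ g {v} {i} i≢v = if-no (i ≟ v) i≢v

Σℕ-erase : ∀ m (g : Fin m → ℕ) v → Σℕ m g ≡ g v ℕ.+ Σℕ m (erase g v)
Σℕ-erase (suc m) g zero    = refl
Σℕ-erase (suc m) g (suc v) = trans (cong (g zero ℕ.+_) (Σℕ-erase m (g ∘ suc) v)) (ℕ-+-left-comm (g zero) (g (suc v)) _)

Σℕ-≥-point : ∀ m (g : Fin m → ℕ) v → g v ≤ Σℕ m g
Σℕ-≥-point m g v = subst (g v ≤_) (sym (Σℕ-erase m g v)) (ℕP.m≤m+n (g v) _)

Σℕ-≥-pair : ∀ m (g : Fin m → ℕ) {i j} → i ≢ j → g i ℕ.+ g j ≤ Σℕ m g
Σℕ-≥-pair m g {i} {j} i≢j = subst (g i ℕ.+ g j ≤_) (sym (Σℕ-erase m g i))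
  (ℕP.+-monoʳ-≤ (g i) (subst (_≤ Σℕ m (erase g i)) (erase-≢ g (i≢j ∘ sym)) (Σℕ-≥-point m (erase g i) j)))

Σℕ-≥-triple : ∀ m (g : Fin m → ℕ) {i j k} → i ≢ j → i ≢ k → j ≢ k → g i ℕ.+ (g j ℕ.+ g k) ≤ Σℕ m g
Σℕ-≥-triple m g {i} {j} {k} i≢j i≢k j≢k = subst (g i ℕ.+ (g j ℕ.+ g k) ≤_) (sym (Σℕ-erase m g i))
  (ℕP.+-monoʳ-≤ (g i) (subst₂ (λ a b → a ℕ.+ b ≤ Σℕ m (erase g i))
    (erase-≢ g (i≢j ∘ sym)) (erase-≢ g (i≢k ∘ sym)) (Σℕ-≥-pair m (erase g i) j≢k)))

sign-suc : ∀ k → sign (suc k) ≡ - sign k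
sign-suc zero          = refl
sign-suc (suc zero)    = refl
sign-suc (suc (suc k)) = sign-suc k

sign-+ : ∀ a b → sign (a ℕ.+ b) ≡ sign a * sign b
sign-+ zero    b = sym (ℚP.*-identityˡ _)
sign-+ (suc a) b = begin
  sign (suc (a ℕ.+ b))  ≡⟨ sign-suc (a ℕ.+ b) ⟩
  - sign (a ℕ.+ b)      ≡⟨ cong -_ (sign-+ a b) ⟩
  - (sign a * sign b)   ≡⟨ ℚP.neg-distribˡ-* (sign a) (sign b) ⟩
  - sign a * sign b     ≡⟨ cong (_* sign b) (sym (sign-suc a)) ⟩
  sign (suc a) * sign b ∎

sign-*-sign : ∀ k → sign k * sign k ≡ 1ℚ
sign-*-sign zero          = refl
sign-*-sign (suc zero)    = refl
sign-*-sign (suc (suc k)) = sign-*-sign k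

sign-cancel : ∀ k x → sign k * (sign k * x) ≡ x
sign-cancel k x = begin
  sign k * (sign k * x) ≡⟨ ℚP.*-assoc (sign k) (sign k) x ⟨
  sign k * sign k * x   ≡⟨ cong (_* x) (sign-*-sign k) ⟩
  1ℚ * x                ≡⟨ ℚP.*-identityˡ x ⟩
  x                     ∎

x∈p─q⁻ : ∀ {n} {p q : Subset n} {x : Fin n} → x ∈ p ─ q → x ∈ p × x ∉ q
x∈p─q⁻ {p = _ ∷ _} {inside  ∷ _} {zero}  ()
x∈p─q⁻ {p = _ ∷ _} {outside ∷ _} {zero}  here      = here , λ ()
x∈p─q⁻ {p = _ ∷ _} {_       ∷ _} {suc x} (there h) with x∈p─q⁻ h
... | x∈p , x∉q = there x∈p , x∉q ∘ drop-there

module _ {n : ℕ} where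

  x∈p∪⁅x⁆ : (p : Subset n) (x : Fin n) → x ∈ p ∪ ⁅ x ⁆
  x∈p∪⁅x⁆ p x = x∈p∪q⁺ (inj₂ (x∈⁅x⁆ x))

  x∈p⇒x∈p∪⁅y⁆ : {p : Subset n} {x : Fin n} (y : Fin n) → x ∈ p → x ∈ p ∪ ⁅ y ⁆
  x∈p⇒x∈p∪⁅y⁆ y x∈p = x∈p∪q⁺ (inj₁ x∈p)

  x∈p∪⁅y⁆⁻ : (p : Subset n) (y : Fin n) {x : Fin n} → x ∈ p ∪ ⁅ y ⁆ → x ≡ y ⊎ x ∈ p
  x∈p∪⁅y⁆⁻ p y x∈ = [ inj₂ , inj₁ ∘ x∈⁅y⁆⇒x≡y y ]′ (x∈p∪q⁻ p ⁅ y ⁆ x∈)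

  x∈p-y⇒x∈p : {p : Subset n} {x y : Fin n} → x ∈ p - y → x ∈ p
  x∈p-y⇒x∈p {p} {y = y} = p─q⊆p p ⁅ y ⁆

  x∈p-y⇒x≢y : {p : Subset n} {x y : Fin n} → x ∈ p - y → x ≢ y
  x∈p-y⇒x≢y x∈ refl = proj₂ (x∈p─q⁻ x∈) (x∈⁅x⁆ _)

  x∉p-x : (p : Subset n) (x : Fin n) → x ∉ p - x
  x∉p-x p x x∈ = x∈p-y⇒x≢y x∈ refl

  p-x∪⁅x⁆≡p : {p : Subset n} {x : Fin n} → x ∈ p → (p - x) ∪ ⁅ x ⁆ ≡ p
  p-x∪⁅x⁆≡p {p} {x} x∈p = ⊆-antisym to from
    where
    to : (p - x) ∪ ⁅ x ⁆ ⊆ p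
    to y∈ with x∈p∪⁅y⁆⁻ (p - x) x y∈
    ... | inj₁ refl = x∈p
    ... | inj₂ y∈p-x = x∈p-y⇒x∈p y∈p-x
    from : p ⊆ (p - x) ∪ ⁅ x ⁆
    from {y} y∈p with y ≟ x
    ... | yes refl = x∈p∪⁅x⁆ (p - x) x
    ... | no y≢x   = x∈p⇒x∈p∪⁅y⁆ x (x∈p∧x≢y⇒x∈p-y y∈p y≢x)

  p∪⁅x⁆-x≡p : {p : Subset n} {x : Fin n} → x ∉ p → (p ∪ ⁅ x ⁆) - x ≡ p
  p∪⁅x⁆-x≡p {p} {x} x∉p = ⊆-antisym to from
    where
    to : (p ∪ ⁅ x ⁆) - x ⊆ p
    to y∈ with x∈p∪⁅y⁆⁻ p x (x∈p-y⇒x∈p y∈)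
    ... | inj₁ y≡x = ⊥-elim (x∈p-y⇒x≢y y∈ y≡x)
    ... | inj₂ y∈p = y∈p
    from : p ⊆ (p ∪ ⁅ x ⁆) - x
    from y∈p = x∈p∧x≢y⇒x∈p-y (x∈p⇒x∈p∪⁅y⁆ x y∈p) (λ { refl → x∉p y∈p })

  p∪⁅x⁆-y≡p-y∪⁅x⁆ : (p : Subset n) {x y : Fin n} → x ≢ y → (p ∪ ⁅ x ⁆) - y ≡ (p - y) ∪ ⁅ x ⁆
  p∪⁅x⁆-y≡p-y∪⁅x⁆ p {x} {y} x≢y = ⊆-antisym to from
    where
    to : (p ∪ ⁅ x ⁆) - y ⊆ (p - y) ∪ ⁅ x ⁆
    to z∈ with x∈p∪⁅y⁆⁻ p x (x∈p-y⇒x∈p z∈)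
    ... | inj₁ refl = x∈p∪⁅x⁆ (p - y) x
    ... | inj₂ z∈p  = x∈p⇒x∈p∪⁅y⁆ x (x∈p∧x≢y⇒x∈p-y z∈p (x∈p-y⇒x≢y z∈))
    from : (p - y) ∪ ⁅ x ⁆ ⊆ (p ∪ ⁅ x ⁆) - y
    from z∈ with x∈p∪⁅y⁆⁻ (p - y) x z∈
    ... | inj₁ refl  = x∈p∧x≢y⇒x∈p-y (x∈p∪⁅x⁆ p x) x≢y
    ... | inj₂ z∈p-y = x∈p∧x≢y⇒x∈p-y (x∈p⇒x∈p∪⁅y⁆ x (x∈p-y⇒x∈p z∈p-y)) (x∈p-y⇒x≢y z∈p-y)

∣p∪⁅x⁆∣≡1+∣p∣ : ∀ {n} (p : Subset n) {x : Fin n} → x ∉ p → ∣ p ∪ ⁅ x ⁆ ∣ ≡ suc ∣ p ∣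
∣p∪⁅x⁆∣≡1+∣p∣ (outside ∷ p) {zero}  x∉p = cong (suc ∘ ∣_∣) (∪-identityʳ p)
∣p∪⁅x⁆∣≡1+∣p∣ (inside  ∷ p) {zero}  x∉p = ⊥-elim (x∉p here)
∣p∪⁅x⁆∣≡1+∣p∣ (outside ∷ p) {suc x} x∉p = ∣p∪⁅x⁆∣≡1+∣p∣ p (x∉p ∘ there)
∣p∪⁅x⁆∣≡1+∣p∣ (inside  ∷ p) {suc x} x∉p = cong suc (∣p∪⁅x⁆∣≡1+∣p∣ p (x∉p ∘ there))

∣p∣≡1+∣p-x∣ : ∀ {n} (p : Subset n) {x : Fin n} → x ∈ p → ∣ p ∣ ≡ suc ∣ p - x ∣
∣p∣≡1+∣p-x∣ p {x} x∈p = trans (cong ∣_∣ (sym (p-x∪⁅x⁆≡p x∈p))) (∣p∪⁅x⁆∣≡1+∣p∣ (p - x) (x∉p-x p x))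

𝟙 : Bool → ℕ
𝟙 b = if b then 1 else 0

count<-zero : ∀ {m} (σ : Subset (suc m)) → count< zero σ ≡ 0
count<-zero {m} σ = Σℕ-zero (suc m) (λ j → term j (does (j ∈? σ)))
  where
  term : ∀ (j : Fin (suc m)) b → (if b then 𝟙 (does (j <? zero {n = m})) else 0) ≡ 0
  term zero    true  = refl
  term (suc j) true  = refl
  term _       false = refl

count<-∪⁅⁆ : ∀ {m} (σ : Subset m) (v i : Fin m) → v ∉ σ →
             count< i (σ ∪ ⁅ v ⁆) ≡ count< i σ ℕ.+ 𝟙 (does (v <? i))
count<-∪⁅⁆ σ zero    zero    v∉σ = trans (count<-zero (σ ∪ ⁅ zero ⁆)) (sym (cong (ℕ._+ 0) (count<-zero σ)))
count<-∪⁅⁆ σ (suc v) zero    v∉σ = trans (count<-zero (σ ∪ ⁅ suc v ⁆)) (sym (cong (ℕ._+ 0) (count<-zero σ)))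
count<-∪⁅⁆ (inside  ∷ σ) zero    (suc i) v∉σ = ⊥-elim (v∉σ here)
count<-∪⁅⁆ (outside ∷ σ) zero    (suc i) v∉σ =
  trans (cong (suc ∘ count< i) (∪-identityʳ σ)) (ℕP.+-comm 1 _)
count<-∪⁅⁆ (outside ∷ σ) (suc v) (suc i) v∉σ = count<-∪⁅⁆ σ v i (v∉σ ∘ there)
count<-∪⁅⁆ (inside  ∷ σ) (suc v) (suc i) v∉σ = cong suc (count<-∪⁅⁆ σ v i (v∉σ ∘ there))

𝟙<-flip : ∀ {m} {i v : Fin m} → i ≢ v → 𝟙 (does (v <? i)) ℕ.+ 𝟙 (does (i <? v)) ≡ 1
𝟙<-flip {i = i} {v} i≢v = go (v <? i) (i <? v)
  where
  go : (v<?i : Dec (v Fin.< i)) (i<?v : Dec (i Fin.< v)) → 𝟙 (does v<?i) ℕ.+ 𝟙 (does i<?v) ≡ 1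
  go (yes v<i) (yes i<v) = ⊥-elim (ℕP.<-asym v<i i<v)
  go (yes _)   (no _)    = refl
  go (no _)    (yes _)   = refl
  go (no v≮i)  (no i≮v)  = ⊥-elim (i≢v (toℕ-injective (ℕP.≤-antisym (ℕP.≮⇒≥ v≮i) (ℕP.≮⇒≥ i≮v))))

-- Chains and cones

Chain : ℕ → Set
Chain m = Subset m → ℚ

Avoids : ∀ {m} → Fin m → Chain m → Set
Avoids v c = ∀ ρ → v ∈ ρ → c ρ ≡ 0ℚ

ε : ∀ {m} → Fin m → Subset m → ℚ
ε v σ = sign (count< v σ)

ε-cancel : ∀ {m} (v : Fin m) σ x → ε v σ * (ε v σ * x) ≡ x
ε-cancel v σ = sign-cancel (count< v σ)

-- Exactly one of i and v precedes the other, so inserting both into σ - v in either order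
-- gives opposite signs.
ε-anticommute : ∀ {m} {σ : Subset m} {i v} → i ≢ v → i ∉ σ → v ∈ σ →
                ε i σ * ε v ((σ - v) ∪ ⁅ i ⁆) ≡ - (ε v (σ - v) * ε i (σ - v))
ε-anticommute {σ = σ} {i} {v} i≢v i∉σ v∈σ = begin
  ε i σ * ε v ((σ - v) ∪ ⁅ i ⁆)        ≡⟨ cong₂ (λ k l → sign k * sign l) count-i count-v ⟩
  sign (a ℕ.+ x) * sign (b ℕ.+ y)     ≡⟨ cong₂ _*_ (sign-+ a x) (sign-+ b y) ⟩
  sign a * sign x * (sign b * sign y) ≡⟨ regroup (sign a) (sign x) (sign b) (sign y) ⟩
  sign x * sign y * (sign b * sign a) ≡⟨ cong (_* (sign b * sign a)) (trans (sym (sign-+ x y))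
                                                                            (cong sign (𝟙<-flip i≢v))) ⟩
  - 1ℚ * (sign b * sign a)            ≡⟨ neg-one-* (sign b * sign a) ⟩
  - (sign b * sign a)                 ∎
  where
  a = count< i (σ - v)
  b = count< v (σ - v)
  x = 𝟙 (does (v <? i))
  y = 𝟙 (does (i <? v))
  count-i : count< i σ ≡ a ℕ.+ x
  count-i = trans (cong (count< i) (sym (p-x∪⁅x⁆≡p v∈σ))) (count<-∪⁅⁆ (σ - v) v i (x∉p-x σ v))
  count-v : count< v ((σ - v) ∪ ⁅ i ⁆) ≡ b ℕ.+ y
  count-v = count<-∪⁅⁆ (σ - v) i v (i∉σ ∘ x∈p-y⇒x∈p)
  regroup : ∀ A X B Y → A * X * (B * Y) ≡ X * Y * (B * A)
  regroup = solve-∀ ℚ-ring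
  neg-one-* : ∀ A → - 1ℚ * A ≡ - A
  neg-one-* = solve-∀ ℚ-ring

cone : ∀ {m} → Fin m → Chain m → Chain m
cone v c τ = if does (v ∈? τ) then ε v (τ - v) * c (τ - v) else 0ℚ

term≡0 : ∀ b (s : ℚ) {x} → x ≡ 0ℚ → (if b then 0ℚ else s * x) ≡ 0ℚ
term≡0 true  s x≡0 = refl
term≡0 false s x≡0 = trans (cong (s *_) x≡0) (ℚP.*-zeroʳ s)

module _ {m : ℕ} where

  ∂-cong : {a b : Chain m} → (∀ τ → a τ ≡ b τ) → ∀ σ → ∂ a σ ≡ ∂ b σ
  ∂-cong a≗b σ = Σℚ-cong m (λ i → cong (λ t → if does (i ∈? σ) then 0ℚ else ε i σ * t) (a≗b (σ ∪ ⁅ i ⁆)))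

  ∂-+ : (a b : Chain m) → ∀ σ → ∂ (λ τ → a τ + b τ) σ ≡ ∂ a σ + ∂ b σ
  ∂-+ a b σ = trans (Σℚ-cong m (λ i → term (does (i ∈? σ)) (ε i σ) (a (σ ∪ ⁅ i ⁆)) (b (σ ∪ ⁅ i ⁆))))
                    (Σℚ-+ m _ _)
    where
    term : ∀ b s x y → (if b then 0ℚ else s * (x + y)) ≡ (if b then 0ℚ else s * x) + (if b then 0ℚ else s * y)
    term true  s x y = refl
    term false s x y = ℚP.*-distribˡ-+ s x y

  ∂-neg : (c : Chain m) → ∀ σ → ∂ (λ τ → - c τ) σ ≡ - ∂ c σ
  ∂-neg c σ = trans (Σℚ-cong m (λ i → term (does (i ∈? σ)) (ε i σ) (c (σ ∪ ⁅ i ⁆)))) (Σℚ-neg m _)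
    where
    term : ∀ b s x → (if b then 0ℚ else s * - x) ≡ - (if b then 0ℚ else s * x)
    term true  s x = refl
    term false s x = sym (ℚP.neg-distribʳ-* s x)

  ∂-zero : ∀ σ → ∂ {m} (λ _ → 0ℚ) σ ≡ 0ℚ
  ∂-zero σ = Σℚ-zero m (λ i → term≡0 (does (i ∈? σ)) (ε i σ) refl)

  ∂-avoids : ∀ {v c} → Avoids v c → Avoids v (∂ c)
  ∂-avoids {v} c-avoids σ v∈σ =
    Σℚ-zero m (λ i → term≡0 (does (i ∈? σ)) (ε i σ) (c-avoids (σ ∪ ⁅ i ⁆) (x∈p⇒x∈p∪⁅y⁆ i v∈σ)))

  cone-∉ : ∀ v c {τ} → v ∉ τ → cone {m} v c τ ≡ 0ℚ
  cone-∉ v c {τ} v∉τ = if-no (v ∈? τ) v∉τ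

  cone-∈ : ∀ v c {τ} → v ∈ τ → cone {m} v c τ ≡ ε v (τ - v) * c (τ - v)
  cone-∈ v c {τ} v∈τ = if-yes (v ∈? τ) v∈τ

  cone-∪⁅⁆ : ∀ v c {ρ} → v ∉ ρ → cone {m} v c (ρ ∪ ⁅ v ⁆) ≡ ε v ρ * c ρ
  cone-∪⁅⁆ v c {ρ} v∉ρ = trans (cone-∈ v c (x∈p∪⁅x⁆ ρ v)) (cong (λ τ → ε v τ * c τ) (p∪⁅x⁆-x≡p v∉ρ))

  cone-cong : ∀ v {a b : Chain m} → (∀ τ → a τ ≡ b τ) → ∀ τ → cone v a τ ≡ cone v b τ
  cone-cong v a≗b τ = cong (λ t → if does (v ∈? τ) then ε v (τ - v) * t else 0ℚ) (a≗b (τ - v))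

  cone-neg : ∀ v (c : Chain m) τ → cone v (λ ρ → - c ρ) τ ≡ - cone v c τ
  cone-neg v c τ = term (does (v ∈? τ)) (ε v (τ - v)) (c (τ - v))
    where
    term : ∀ b s x → (if b then s * - x else 0ℚ) ≡ - (if b then s * x else 0ℚ)
    term true  s x = sym (ℚP.neg-distribʳ-* s x)
    term false s x = refl

  ∂-cone-∉ : ∀ v c {σ} → v ∉ σ → ∂ (cone {m} v c) σ ≡ c σ
  ∂-cone-∉ v c {σ} v∉σ = begin
    ∂ (cone v c) σ                ≡⟨ Σℚ-single m _ v off-v ⟩
    (if does (v ∈? σ) then 0ℚ else ε v σ * cone v c (σ ∪ ⁅ v ⁆)) ≡⟨ if-no (v ∈? σ) v∉σ ⟩
    ε v σ * cone v c (σ ∪ ⁅ v ⁆)  ≡⟨ cong (ε v σ *_) (cone-∪⁅⁆ v c v∉σ) ⟩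
    ε v σ * (ε v σ * c σ)         ≡⟨ ε-cancel v σ (c σ) ⟩
    c σ                           ∎
    where
    v∉σ∪⁅i⁆ : ∀ {i} → i ≢ v → v ∉ σ ∪ ⁅ i ⁆
    v∉σ∪⁅i⁆ i≢v v∈ = [ i≢v ∘ sym , v∉σ ]′ (x∈p∪⁅y⁆⁻ σ _ v∈)
    off-v : ∀ i → i ≢ v → (if does (i ∈? σ) then 0ℚ else ε i σ * cone v c (σ ∪ ⁅ i ⁆)) ≡ 0ℚ
    off-v i i≢v = term≡0 (does (i ∈? σ)) (ε i σ) (cone-∉ v c (v∉σ∪⁅i⁆ i≢v))

  ∂-cone-∈ : ∀ v {c} → Avoids v c → ∀ {σ} → v ∈ σ → ∂ (cone {m} v c) σ ≡ - (ε v (σ - v) * ∂ c (σ - v))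
  ∂-cone-∈ v {c} c-avoids {σ} v∈σ = begin
    ∂ (cone v c) σ            ≡⟨ Σℚ-cong m term ⟩
    Σℚ m (λ i → - (S * U i))  ≡⟨ Σℚ-neg m (λ i → S * U i) ⟩
    - Σℚ m (λ i → S * U i)    ≡⟨ cong -_ (Σℚ-*ˡ m S U) ⟩
    - (S * ∂ c (σ - v))       ∎
    where
    S = ε v (σ - v)
    U : Fin m → ℚ
    U i = if does (i ∈? (σ - v)) then 0ℚ else ε i (σ - v) * c ((σ - v) ∪ ⁅ i ⁆)
    -S*0≡0 : - (S * 0ℚ) ≡ 0ℚ
    -S*0≡0 = cong -_ (ℚP.*-zeroʳ S)
    neg-assoc : ∀ A B C → - (A * B) * C ≡ - (A * (B * C))
    neg-assoc = solve-∀ ℚ-ring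
    term : ∀ i → (if does (i ∈? σ) then 0ℚ else ε i σ * cone v c (σ ∪ ⁅ i ⁆)) ≡ - (S * U i)
    term i with i ≟ v | i ∈? σ
    ... | yes refl | no v∉σ = ⊥-elim (v∉σ v∈σ)
    ... | yes refl | yes _  = sym (trans (cong (λ t → - (S * t)) (term≡0 (does (v ∈? (σ - v))) (ε v (σ - v))
                                    (trans (cong c (p-x∪⁅x⁆≡p v∈σ)) (c-avoids σ v∈σ)))) -S*0≡0)
    ... | no i≢v   | yes i∈σ =
      sym (trans (cong (λ t → - (S * t)) (if-yes (i ∈? (σ - v)) (x∈p∧x≢y⇒x∈p-y i∈σ i≢v))) -S*0≡0)
    ... | no i≢v   | no i∉σ  = begin
      ε i σ * cone v c (σ ∪ ⁅ i ⁆)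
        ≡⟨ cong (ε i σ *_) (cone-∈ v c (x∈p⇒x∈p∪⁅y⁆ i v∈σ)) ⟩
      ε i σ * (ε v ((σ ∪ ⁅ i ⁆) - v) * c ((σ ∪ ⁅ i ⁆) - v))
        ≡⟨ cong (λ τ → ε i σ * (ε v τ * c τ)) (p∪⁅x⁆-y≡p-y∪⁅x⁆ σ i≢v) ⟩
      ε i σ * (ε v τ * c τ)
        ≡⟨ ℚP.*-assoc (ε i σ) (ε v τ) (c τ) ⟨
      ε i σ * ε v τ * c τ
        ≡⟨ cong (_* c τ) (ε-anticommute i≢v i∉σ v∈σ) ⟩
      - (S * ε i (σ - v)) * c τ
        ≡⟨ neg-assoc S (ε i (σ - v)) (c τ) ⟩
      - (S * (ε i (σ - v) * c τ))
        ≡⟨ cong (λ t → - (S * t)) (if-no (i ∈? (σ - v)) (i∉σ ∘ x∈p-y⇒x∈p)) ⟨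
      - (S * U i)
        ∎
      where τ = (σ - v) ∪ ⁅ i ⁆

  ∂-cone : ∀ v {c} → Avoids v c → ∀ σ → ∂ (cone {m} v c) σ ≡ c σ + - cone v (∂ c) σ
  ∂-cone v {c} c-avoids σ = go (v ∈? σ)
    where
    go : Dec (v ∈ σ) → ∂ (cone v c) σ ≡ c σ + - cone v (∂ c) σ
    go (no v∉σ) = begin
      ∂ (cone v c) σ             ≡⟨ ∂-cone-∉ v c v∉σ ⟩
      c σ                        ≡⟨ ℚP.+-identityʳ (c σ) ⟨
      c σ + - 0ℚ                 ≡⟨ cong (λ t → c σ + - t) (cone-∉ v (∂ c) v∉σ) ⟨
      c σ + - cone v (∂ c) σ     ∎
    go (yes v∈σ) = begin
      ∂ (cone v c) σ                  ≡⟨ ∂-cone-∈ v c-avoids v∈σ ⟩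
      - (ε v (σ - v) * ∂ c (σ - v))   ≡⟨ cong -_ (cone-∈ v (∂ c) v∈σ) ⟨
      - cone v (∂ c) σ                ≡⟨ ℚP.+-identityˡ _ ⟨
      0ℚ + - cone v (∂ c) σ           ≡⟨ cong (_+ - cone v (∂ c) σ) (c-avoids σ v∈σ) ⟨
      c σ + - cone v (∂ c) σ          ∎

-- Deletion and link

Deletion : ∀ {m} → (Subset m → Set) → Fin m → Subset m → Set
Deletion F v σ = F σ × v ∉ σ

Link : ∀ {m} → (Subset m → Set) → Fin m → Subset m → Set
Link F v σ = F (σ ∪ ⁅ v ⁆) × v ∉ σ

Acyclic< : ∀ {m} → (Subset m → Set) → ℕ → Set
Acyclic< F n = ∀ d → d < n → HomologyVanishes F d

x*y≢0⇒y≢0 : ∀ x {y : ℚ} → x * y ≢ 0ℚ → y ≢ 0ℚ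
x*y≢0⇒y≢0 x x*y≢0 refl = x*y≢0 (ℚP.*-zeroʳ x)

module _ {m : ℕ} {F : Subset m → Set} {d : ℕ} where

  IsChain-mono : {G : Subset m → Set} {c : Chain m} → (∀ σ → F σ → G σ) → IsChain F d c → IsChain G d c
  IsChain-mono F⇒G c-chain σ c≢0 = Product.map₁ (F⇒G σ) (c-chain σ c≢0)

  IsChain-+ : {a b : Chain m} → IsChain F d a → IsChain F d b → IsChain F d (λ τ → a τ + b τ)
  IsChain-+ {a} {b} a-chain b-chain τ a+b≢0 with a τ ℚP.≟ 0ℚ
  ... | no a≢0  = a-chain τ a≢0
  ... | yes a≡0 = b-chain τ (λ b≡0 → a+b≢0 (cong₂ _+_ a≡0 b≡0))

  IsChain-neg : {c : Chain m} → IsChain F d c → IsChain F d (λ τ → - c τ)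
  IsChain-neg c-chain τ neg≢0 = c-chain τ (λ c≡0 → neg≢0 (cong -_ c≡0))

module _ {m : ℕ} {F : Subset m → Set} {v : Fin m} {d : ℕ} {c : Chain m} where

  Link-chain-avoids : IsChain (Link F v) d c → Avoids v c
  Link-chain-avoids c-chain ρ v∈ρ with c ρ ℚP.≟ 0ℚ
  ... | yes c≡0 = c≡0
  ... | no c≢0  = ⊥-elim (proj₂ (proj₁ (c-chain ρ c≢0)) v∈ρ)

  cone-IsChain : IsChain (Link F v) d c → IsChain F (suc d) (cone v c)
  cone-IsChain c-chain τ cone≢0 = go (v ∈? τ)
    where
    go : Dec (v ∈ τ) → F τ × ∣ τ ∣ ≡ suc d
    go (no v∉τ)  = ⊥-elim (cone≢0 (cone-∉ v c v∉τ))
    go (yes v∈τ) with c-chain (τ - v) (x*y≢0⇒y≢0 (ε v (τ - v)) (cone≢0 ∘ trans (cone-∈ v c v∈τ)))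
    ... | (F[τ-v∪v] , _) , ∣τ-v∣≡d =
      subst F (p-x∪⁅x⁆≡p v∈τ) F[τ-v∪v] , trans (∣p∣≡1+∣p-x∣ τ v∈τ) (cong suc ∣τ-v∣≡d)

module CycleSplit {m : ℕ} (z : Chain m) (v : Fin m) where

  deleted : Chain m
  deleted τ = if does (v ∈? τ) then 0ℚ else z τ

  linked : Chain m
  linked τ = if does (v ∈? τ) then 0ℚ else ε v τ * z (τ ∪ ⁅ v ⁆)

  deleted-avoids : Avoids v deleted
  deleted-avoids ρ v∈ρ = if-yes (v ∈? ρ) v∈ρ

  linked-avoids : Avoids v linked
  linked-avoids ρ v∈ρ = if-yes (v ∈? ρ) v∈ρ

  split : ∀ τ → z τ ≡ deleted τ + cone v linked τ
  split τ = go (v ∈? τ)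
    where
    go : Dec (v ∈ τ) → z τ ≡ deleted τ + cone v linked τ
    go (no v∉τ) = sym (trans (cong₂ _+_ (if-no (v ∈? τ) v∉τ) (cone-∉ v linked v∉τ)) (ℚP.+-identityʳ (z τ)))
    go (yes v∈τ) = sym (begin
      deleted τ + cone v linked τ                      ≡⟨ cong₂ _+_ (deleted-avoids τ v∈τ) (cone-∈ v linked v∈τ) ⟩
      0ℚ + ε v (τ - v) * linked (τ - v)                ≡⟨ ℚP.+-identityˡ _ ⟩
      ε v (τ - v) * linked (τ - v)                     ≡⟨ cong (ε v (τ - v) *_) (if-no (v ∈? (τ - v)) (x∉p-x τ v)) ⟩
      ε v (τ - v) * (ε v (τ - v) * z ((τ - v) ∪ ⁅ v ⁆)) ≡⟨ ε-cancel v (τ - v) _ ⟩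
      z ((τ - v) ∪ ⁅ v ⁆)                              ≡⟨ cong z (p-x∪⁅x⁆≡p v∈τ) ⟩
      z τ                                              ∎)

  module _ {F : Subset m → Set} where

    deleted-IsChain : ∀ {d} → IsChain F d z → IsChain (Deletion F v) d deleted
    deleted-IsChain z-chain ρ deleted≢0 = go (v ∈? ρ)
      where
      go : Dec (v ∈ ρ) → Deletion F v ρ × ∣ ρ ∣ ≡ _
      go (yes v∈ρ) = ⊥-elim (deleted≢0 (deleted-avoids ρ v∈ρ))
      go (no v∉ρ)  = Product.map₁ (_, v∉ρ) (z-chain ρ (deleted≢0 ∘ trans (if-no (v ∈? ρ) v∉ρ)))

    linked-IsChain : ∀ {d} → IsChain F (suc d) z → IsChain (Link F v) d linked
    linked-IsChain z-chain ρ linked≢0 = go (v ∈? ρ)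
      where
      go : Dec (v ∈ ρ) → Link F v ρ × ∣ ρ ∣ ≡ _
      go (yes v∈ρ) = ⊥-elim (linked≢0 (linked-avoids ρ v∈ρ))
      go (no v∉ρ) with z-chain (ρ ∪ ⁅ v ⁆) (x*y≢0⇒y≢0 (ε v ρ) (linked≢0 ∘ trans (if-no (v ∈? ρ) v∉ρ)))
      ... | F[ρ∪v] , ∣ρ∪v∣≡1+d =
        (F[ρ∪v] , v∉ρ) , ℕP.suc-injective (trans (sym (∣p∪⁅x⁆∣≡1+∣p∣ ρ v∉ρ)) ∣ρ∪v∣≡1+d)

    -- Faces containing v are nonempty, so a chain of empty faces has no link part.
    linked-zero : IsChain F 0 z → ∀ ρ → linked ρ ≡ 0ℚ
    linked-zero z-chain ρ = go (v ∈? ρ)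
      where
      go : Dec (v ∈ ρ) → linked ρ ≡ 0ℚ
      go (yes v∈ρ) = linked-avoids ρ v∈ρ
      go (no v∉ρ) with z (ρ ∪ ⁅ v ⁆) ℚP.≟ 0ℚ
      ... | yes z≡0 = trans (if-no (v ∈? ρ) v∉ρ) (trans (cong (ε v ρ *_) z≡0) (ℚP.*-zeroʳ (ε v ρ)))
      ... | no z≢0 with trans (sym (∣p∪⁅x⁆∣≡1+∣p∣ ρ v∉ρ)) (proj₂ (z-chain _ z≢0))
      ... | ()

  module _ (z-cycle : ∀ σ → ∂ z σ ≡ 0ℚ) where

    ∂-split : ∀ σ → ∂ deleted σ + (linked σ + - cone v (∂ linked) σ) ≡ 0ℚ
    ∂-split σ = begin
      ∂ deleted σ + (linked σ + - cone v (∂ linked) σ) ≡⟨ cong (∂ deleted σ +_) (∂-cone v linked-avoids σ) ⟨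
      ∂ deleted σ + ∂ (cone v linked) σ                 ≡⟨ ∂-+ deleted (cone v linked) σ ⟨
      ∂ (λ τ → deleted τ + cone v linked τ) σ           ≡⟨ ∂-cong split σ ⟨
      ∂ z σ                                             ≡⟨ z-cycle σ ⟩
      0ℚ                                                ∎

    linked-cycle : ∀ ρ → ∂ linked ρ ≡ 0ℚ
    linked-cycle ρ = go (v ∈? ρ)
      where
      go : Dec (v ∈ ρ) → ∂ linked ρ ≡ 0ℚ
      go (yes v∈ρ) = ∂-avoids linked-avoids ρ v∈ρ
      go (no v∉ρ)  = begin
        ∂ linked ρ                    ≡⟨ ε-cancel v ρ (∂ linked ρ) ⟨
        ε v ρ * (ε v ρ * ∂ linked ρ)  ≡⟨ cong (ε v ρ *_) (trans (sym (cone-∪⁅⁆ v (∂ linked) v∉ρ)) cone≡0) ⟩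
        ε v ρ * 0ℚ                    ≡⟨ ℚP.*-zeroʳ (ε v ρ) ⟩
        0ℚ                            ∎
        where
        σ = ρ ∪ ⁅ v ⁆
        v∈σ = x∈p∪⁅x⁆ ρ v
        cone≡0 : cone v (∂ linked) σ ≡ 0ℚ
        cone≡0 = ℚ-neg≡0⇒≡0 (begin
          - cone v (∂ linked) σ                            ≡⟨ ℚP.+-identityˡ _ ⟨
          0ℚ + - cone v (∂ linked) σ                       ≡⟨ ℚP.+-identityˡ _ ⟨
          0ℚ + (0ℚ + - cone v (∂ linked) σ)                ≡⟨ cong₂ (λ a b → a + (b + - cone v (∂ linked) σ))
                                                                (∂-avoids deleted-avoids σ v∈σ) (linked-avoids σ v∈σ) ⟨
          ∂ deleted σ + (linked σ + - cone v (∂ linked) σ) ≡⟨ ∂-split σ ⟩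
          0ℚ                                               ∎)

    ∂-deleted : ∀ σ → ∂ deleted σ ≡ - linked σ
    ∂-deleted σ = go (v ∈? σ)
      where
      go : Dec (v ∈ σ) → ∂ deleted σ ≡ - linked σ
      go (yes v∈σ) = trans (∂-avoids deleted-avoids σ v∈σ) (cong -_ (sym (linked-avoids σ v∈σ)))
      go (no v∉σ)  = ℚ-+≡0⇒≡neg (∂ deleted σ) (linked σ) (begin
        ∂ deleted σ + linked σ                            ≡⟨ cong (∂ deleted σ +_) (ℚP.+-identityʳ (linked σ)) ⟨
        ∂ deleted σ + (linked σ + - 0ℚ)                   ≡⟨ cong (λ t → ∂ deleted σ + (linked σ + - t))
                                                               (cone-∉ v (∂ linked) v∉σ) ⟨
        ∂ deleted σ + (linked σ + - cone v (∂ linked) σ)  ≡⟨ ∂-split σ ⟩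
        0ℚ                                                ∎)

    linked-bounds : ∀ {F : Subset m → Set} d → IsChain F d z →
                    (∀ {d'} → d ≡ suc d' → HomologyVanishes (Link F v) d') →
                    Σ[ u ∈ Chain m ] (IsChain (Link F v) d u × (∀ σ → ∂ u σ ≡ linked σ))
    linked-bounds zero    z-chain _ =
      (λ _ → 0ℚ) , (λ _ 0≢0 → ⊥-elim (0≢0 refl)) , (λ σ → trans (∂-zero σ) (sym (linked-zero z-chain σ)))
    linked-bounds (suc d) z-chain link-acyclic =
      link-acyclic refl linked (linked-IsChain z-chain) linked-cycle

HomologyVanishes-cong : ∀ {m} {F G : Subset m → Set} {d} → (∀ σ → F σ ⇔ G σ) →
                        HomologyVanishes F d → HomologyVanishes G d
HomologyVanishes-cong F⇔G F-acyclic z z-chain z-cycle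
  with F-acyclic z (IsChain-mono (Equivalence.from ∘ F⇔G) z-chain) z-cycle
... | w , w-chain , ∂w = w , IsChain-mono (Equivalence.to ∘ F⇔G) w-chain , ∂w

Acyclic<-cong : ∀ {m} {F G : Subset m → Set} {n} → (∀ σ → F σ ⇔ G σ) → Acyclic< F n → Acyclic< G n
Acyclic<-cong F⇔G F-acyclic d d<n = HomologyVanishes-cong F⇔G (F-acyclic d d<n)

cone⇒HomologyVanishes : ∀ {m} (F : Subset m → Set) (v : Fin m) →
                        (∀ σ → v ∉ σ → F σ → F (σ ∪ ⁅ v ⁆)) → ∀ d → HomologyVanishes F d
cone⇒HomologyVanishes F v extend d z z-chain z-cycle =
  cone v deleted , cone-IsChain (IsChain-mono apex (deleted-IsChain z-chain)) , ∂w
  where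
  open CycleSplit z v
  apex : ∀ σ → Deletion F v σ → Link F v σ
  apex σ (Fσ , v∉σ) = extend σ v∉σ Fσ , v∉σ
  ∂w : ∀ σ → ∂ (cone v deleted) σ ≡ z σ
  ∂w σ = begin
    ∂ (cone v deleted) σ                ≡⟨ ∂-cone v deleted-avoids σ ⟩
    deleted σ + - cone v (∂ deleted) σ  ≡⟨ cong (λ t → deleted σ + - t)
                                            (trans (cone-cong v (∂-deleted z-cycle) σ) (cone-neg v linked σ)) ⟩
    deleted σ + - - cone v linked σ     ≡⟨ cong (deleted σ +_) (ℚ-neg-involutive _) ⟩
    deleted σ + cone v linked σ         ≡⟨ split σ ⟨
    z σ                                 ∎

-- Once u fills the link part, deleted + u is a cycle of the deletion, and if w fills it,
-- then w − cone v u fills z.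
module DeletionLink {m} (F : Subset m → Set) (v : Fin m) (restrict : ∀ σ → Link F v σ → F σ)
                    {d} (z : Chain m) (z-chain : IsChain F d z) (z-cycle : ∀ σ → ∂ z σ ≡ 0ℚ)
                    (u : Chain m) (u-chain : IsChain (Link F v) d u)
                    (∂u : ∀ σ → ∂ u σ ≡ CycleSplit.linked z v σ) where
  open CycleSplit z v

  c : Chain m
  c τ = deleted τ + u τ

  c-chain : IsChain (Deletion F v) d c
  c-chain = IsChain-+ (deleted-IsChain z-chain) (IsChain-mono (λ σ l → restrict σ l , proj₂ l) u-chain)

  c-cycle : ∀ σ → ∂ c σ ≡ 0ℚ
  c-cycle σ = trans (∂-+ deleted u σ) (trans (cong₂ _+_ (∂-deleted z-cycle σ) (∂u σ)) (ℚP.+-inverseˡ (linked σ)))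

  lift : Σ[ w ∈ Chain m ] (IsChain (Deletion F v) (suc d) w × (∀ σ → ∂ w σ ≡ c σ)) →
         Σ[ W ∈ Chain m ] (IsChain F (suc d) W × (∀ σ → ∂ W σ ≡ z σ))
  lift (w , w-chain , ∂w) =
    W , IsChain-+ (IsChain-mono (λ σ → proj₁) w-chain) (IsChain-neg (cone-IsChain u-chain)) , ∂W
    where
    W : Chain m
    W τ = w τ + - cone v u τ
    cancel : ∀ a b e → a + b + - (b + - e) ≡ a + e
    cancel = solve-∀ ℚ-ring
    ∂W : ∀ σ → ∂ W σ ≡ z σ
    ∂W σ = begin
      ∂ W σ                                          ≡⟨ ∂-+ w (λ τ → - cone v u τ) σ ⟩
      ∂ w σ + ∂ (λ τ → - cone v u τ) σ               ≡⟨ cong₂ _+_ (∂w σ) (∂-neg (cone v u) σ) ⟩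
      deleted σ + u σ + - ∂ (cone v u) σ             ≡⟨ cong (λ t → deleted σ + u σ + - t)
                                                           (∂-cone v (Link-chain-avoids {F = F} u-chain) σ) ⟩
      deleted σ + u σ + - (u σ + - cone v (∂ u) σ)   ≡⟨ cong (λ t → deleted σ + u σ + - (u σ + - t)) (cone-cong v ∂u σ) ⟩
      deleted σ + u σ + - (u σ + - cone v linked σ)  ≡⟨ cancel (deleted σ) (u σ) (cone v linked σ) ⟩
      deleted σ + cone v linked σ                    ≡⟨ split σ ⟨
      z σ                                            ∎

deletion-link⇒HomologyVanishes : ∀ {m} (F : Subset m → Set) (v : Fin m) → (∀ σ → Link F v σ → F σ) →
  ∀ d → HomologyVanishes (Deletion F v) d → (∀ {d'} → d ≡ suc d' → HomologyVanishes (Link F v) d') →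
  HomologyVanishes F d
deletion-link⇒HomologyVanishes F v restrict d deletion-acyclic link-acyclic z z-chain z-cycle
  with CycleSplit.linked-bounds z v z-cycle d z-chain link-acyclic
... | u , u-chain , ∂u = lift (deletion-acyclic c c-chain c-cycle)
  where open DeletionLink F v restrict z z-chain z-cycle u u-chain ∂u

Acyclic<-deletion-link : ∀ {m} (F : Subset m → Set) (v : Fin m) → (∀ σ → Link F v σ → F σ) → ∀ n →
  Acyclic< (Deletion F v) (suc n) → Acyclic< (Link F v) n → Acyclic< F (suc n)
Acyclic<-deletion-link F v restrict n deletion-acyclic link-acyclic d d<1+n =
  deletion-link⇒HomologyVanishes F v restrict d (deletion-acyclic d d<1+n)
    (λ {d'} d≡1+d' → link-acyclic d' (ℕP.≤-pred (subst (_< suc n) d≡1+d' d<1+n)))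

-- Matching complexes

p-x─q≡p─q : ∀ {n} (p : Subset n) {x : Fin n} {q : Subset n} → x ∈ q → p - x ─ q ≡ p ─ q
p-x─q≡p─q p {x} {q} x∈q = ⊆-antisym to from
  where
  to : p - x ─ q ⊆ p ─ q
  to y∈ with x∈p─q⁻ y∈
  ... | y∈p-x , y∉q = x∈p∧x∉q⇒x∈p─q (x∈p-y⇒x∈p y∈p-x) y∉q
  from : p ─ q ⊆ p - x ─ q
  from y∈ with x∈p─q⁻ y∈
  ... | y∈p , y∉q = x∈p∧x∉q⇒x∈p─q (x∈p∧x≢y⇒x∈p-y y∈p (λ { refl → y∉q x∈q })) y∉q

p⊆q-x⇒∣p∣<∣q∣ : ∀ {n} {p q : Subset n} {x : Fin n} → x ∈ q → p ⊆ q - x → ∣ p ∣ < ∣ q ∣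
p⊆q-x⇒∣p∣<∣q∣ x∈q p⊆q-x = ℕP.≤-<-trans (p⊆q⇒∣p∣≤∣q∣ p⊆q-x) (x∈p⇒∣p-x∣<∣p∣ x∈q)

∣p∣≤0⇒x∉p : ∀ {n} {p : Subset n} {x : Fin n} → ∣ p ∣ ≤ 0 → x ∉ p
∣p∣≤0⇒x∉p ∣p∣≤0 x∈p with ℕP.<-≤-trans (x∈p⇒∣p-x∣<∣p∣ x∈p) ∣p∣≤0
... | ()

module Matchings {p q : ℕ} (es : List (Fin p × Fin q)) where

  endB : Fin (length es) → Fin p
  endB i = proj₁ (edge es i)

  endC : Fin (length es) → Fin q
  endC i = proj₂ (edge es i)

  Meet : Fin (length es) → Fin (length es) → Set
  Meet i j = endB i ≡ endB j ⊎ endC i ≡ endC j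

  meet? : ∀ i j → Dec (Meet i j)
  meet? i j = (endB i ≟ endB j) ⊎-dec (endC i ≟ endC j)

  Meet-sym : ∀ {i j} → Meet i j → Meet j i
  Meet-sym = Sum.map sym sym

  ¬Meet⇒disjoint : ∀ {i j} → ¬ Meet i j → (endB i ≢ endB j) × (endC i ≢ endC j)
  ¬Meet⇒disjoint ¬meet = ¬meet ∘ inj₁ , ¬meet ∘ inj₂

  meeting : Fin (length es) → Subset (length es)
  meeting e = tabulate (does ∘ meet? e)

  ∈meeting⁻ : ∀ {e j} → j ∈ meeting e → Meet e j
  ∈meeting⁻ {e} {j} j∈ = dec-true⁻¹ (meet? e j) (trans (sym (Vec.lookup∘tabulate _ j)) (Vec.[]=⇒lookup j∈))
    where
    dec-true⁻¹ : ∀ {a} {A : Set a} (A? : Dec A) → does A? ≡ true → A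
    dec-true⁻¹ (yes a) _ = a

  ∈meeting⁺ : ∀ {e j} → Meet e j → j ∈ meeting e
  ∈meeting⁺ {e} {j} meet = Vec.lookup⇒[]= j _ (trans (Vec.lookup∘tabulate _ j) (dec-true (meet? e j) meet))

  e∈meeting : ∀ e → e ∈ meeting e
  e∈meeting e = ∈meeting⁺ (inj₁ refl)

  p─meeting-e⊆q-e : ∀ {p q e} → p ⊆ q → p ─ meeting e ⊆ q - e
  p─meeting-e⊆q-e {e = e} p⊆q x∈ with x∈p─q⁻ x∈
  ... | x∈p , x∉meeting = x∈p∧x≢y⇒x∈p-y (p⊆q x∈p) (λ { refl → x∉meeting (e∈meeting e) })

  IsMatching⇒¬Meet : ∀ {σ i j} → IsMatching es σ → i ∈ σ → j ∈ σ → i ≢ j → ¬ Meet i j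
  IsMatching⇒¬Meet σ-matching i∈σ j∈σ i≢j = [ proj₁ disjoint , proj₂ disjoint ]′
    where disjoint = σ-matching _ _ i∈σ j∈σ i≢j

  IsMatching-⊆ : ∀ {σ τ} → σ ⊆ τ → IsMatching es τ → IsMatching es σ
  IsMatching-⊆ σ⊆τ τ-matching i j i∈σ j∈σ = τ-matching i j (σ⊆τ i∈σ) (σ⊆τ j∈σ)

  IsMatching-∪⁅⁆ : ∀ {σ e} → IsMatching es σ → (∀ {j} → j ∈ σ → ¬ Meet e j) → IsMatching es (σ ∪ ⁅ e ⁆)
  IsMatching-∪⁅⁆ {σ} {e} σ-matching apart i j i∈ j∈ i≢j with x∈p∪⁅y⁆⁻ σ e i∈ | x∈p∪⁅y⁆⁻ σ e j∈
  ... | inj₁ refl | inj₁ refl = ⊥-elim (i≢j refl)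
  ... | inj₁ refl | inj₂ j∈σ  = ¬Meet⇒disjoint (apart j∈σ)
  ... | inj₂ i∈σ  | inj₁ refl = ¬Meet⇒disjoint (apart i∈σ ∘ Meet-sym)
  ... | inj₂ i∈σ  | inj₂ j∈σ  = σ-matching i j i∈σ j∈σ i≢j

  MatchingIn : Subset (length es) → Subset (length es) → Set
  MatchingIn A σ = IsMatching es σ × σ ⊆ A

  MatchingIn-deletion : ∀ {A e} σ → MatchingIn (A - e) σ ⇔ Deletion (MatchingIn A) e σ
  MatchingIn-deletion {A} {e} σ = mk⇔
    (λ (σ-matching , σ⊆A-e) → (σ-matching , x∈p-y⇒x∈p ∘ σ⊆A-e) , λ e∈σ → x∉p-x A e (σ⊆A-e e∈σ))
    (λ ((σ-matching , σ⊆A) , e∉σ) → σ-matching , λ i∈σ → x∈p∧x≢y⇒x∈p-y (σ⊆A i∈σ) (λ { refl → e∉σ i∈σ }))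

  MatchingIn-link : ∀ {A e} → e ∈ A → ∀ σ → MatchingIn (A ─ meeting e) σ ⇔ Link (MatchingIn A) e σ
  MatchingIn-link {A} {e} e∈A σ = mk⇔ to from
    where
    to : MatchingIn (A ─ meeting e) σ → Link (MatchingIn A) e σ
    to (σ-matching , σ⊆A─N) =
      (IsMatching-∪⁅⁆ σ-matching apart , σ∪e⊆A) , λ e∈σ → proj₂ (x∈p─q⁻ (σ⊆A─N e∈σ)) (e∈meeting e)
      where
      apart : ∀ {j} → j ∈ σ → ¬ Meet e j
      apart j∈σ = proj₂ (x∈p─q⁻ (σ⊆A─N j∈σ)) ∘ ∈meeting⁺
      σ∪e⊆A : σ ∪ ⁅ e ⁆ ⊆ A
      σ∪e⊆A i∈ = [ (λ { refl → e∈A }) , proj₁ ∘ x∈p─q⁻ ∘ σ⊆A─N ]′ (x∈p∪⁅y⁆⁻ σ e i∈)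
    from : Link (MatchingIn A) e σ → MatchingIn (A ─ meeting e) σ
    from ((σ∪e-matching , σ∪e⊆A) , e∉σ) = IsMatching-⊆ (p⊆p∪q _) σ∪e-matching , λ {i} i∈σ →
      x∈p∧x∉q⇒x∈p─q (σ∪e⊆A (x∈p⇒x∈p∪⁅y⁆ e i∈σ))
        (IsMatching⇒¬Meet σ∪e-matching (x∈p∪⁅x⁆ σ e) (x∈p⇒x∈p∪⁅y⁆ e i∈σ) (λ { refl → e∉σ i∈σ }) ∘ ∈meeting⁻)

  MatchingIn-restrict : ∀ {A e} σ → Link (MatchingIn A) e σ → MatchingIn A σ
  MatchingIn-restrict σ ((σ∪e-matching , σ∪e⊆A) , _) = IsMatching-⊆ (p⊆p∪q _) σ∪e-matching , σ∪e⊆A ∘ p⊆p∪q _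

  Acyclic<-MatchingIn : ∀ {A e} → e ∈ A → ∀ n →
    Acyclic< (MatchingIn (A - e)) (suc n) → Acyclic< (MatchingIn (A ─ meeting e)) n → Acyclic< (MatchingIn A) (suc n)
  Acyclic<-MatchingIn {A} {e} e∈A n deletion-acyclic link-acyclic =
    Acyclic<-deletion-link (MatchingIn A) e MatchingIn-restrict n
      (Acyclic<-cong MatchingIn-deletion deletion-acyclic) (Acyclic<-cong (MatchingIn-link e∈A) link-acyclic)

  isolated⇒Acyclic< : ∀ {A e} → e ∈ A → (∀ {j} → j ∈ A → j ≢ e → ¬ Meet e j) → ∀ n → Acyclic< (MatchingIn A) n
  isolated⇒Acyclic< {A} {e} e∈A isolated n d _ = cone⇒HomologyVanishes (MatchingIn A) e extend d
    where
    extend : ∀ σ → e ∉ σ → MatchingIn A σ → MatchingIn A (σ ∪ ⁅ e ⁆)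
    extend σ e∉σ (σ-matching , σ⊆A) =
      IsMatching-∪⁅⁆ σ-matching (λ j∈σ → isolated (σ⊆A j∈σ) (λ { refl → e∉σ j∈σ })) ,
      λ i∈ → [ (λ { refl → e∈A }) , σ⊆A ]′ (x∈p∪⁅y⁆⁻ σ e i∈)

  -- Deleting the other edges at the B-end of e one by one leaves e isolated.
  pendant⇒Acyclic< : ∀ N {A e} → ∣ A ∣ ≤ N → e ∈ A → (∀ {j} → j ∈ A → endC j ≡ endC e → j ≡ e) → ∀ n →
    (∀ {v} → v ∈ A → endB v ≡ endB e → v ≢ e → Acyclic< (MatchingIn (A ─ meeting v)) n) →
    Acyclic< (MatchingIn A) (suc n)
  pendant⇒Acyclic< N {A} {e} ∣A∣≤N e∈A pendant n link-acyclic
    with any? (λ v → v ∈? A ×-dec (endB v ≟ endB e) ×-dec ¬? (v ≟ e))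
  ... | no none = isolated⇒Acyclic< e∈A isolated (suc n)
    where
    isolated : ∀ {j} → j ∈ A → j ≢ e → ¬ Meet e j
    isolated j∈A j≢e (inj₁ same-b) = none (_ , j∈A , sym same-b , j≢e)
    isolated j∈A j≢e (inj₂ same-c) = j≢e (pendant j∈A (sym same-c))
  ... | yes (v , v∈A , same-b , v≢e) with N
  ...   | zero  = ⊥-elim (∣p∣≤0⇒x∉p ∣A∣≤N v∈A)
  ...   | suc N = Acyclic<-MatchingIn v∈A n
    (pendant⇒Acyclic< N (ℕP.≤-pred (ℕP.<-≤-trans (x∈p⇒∣p-x∣<∣p∣ v∈A) ∣A∣≤N)) (x∈p∧x≢y⇒x∈p-y e∈A (v≢e ∘ sym))
      (pendant ∘ x∈p-y⇒x∈p) n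
      (λ {v'} v'∈ same-b' v'≢e → subst (λ B → Acyclic< (MatchingIn B) n)
        (sym (p-x─q≡p─q A (∈meeting⁺ (inj₁ (trans same-b' (sym same-b))))))
        (link-acyclic (x∈p-y⇒x∈p v'∈) same-b' v'≢e)))
    (link-acyclic v∈A same-b v≢e)

-- Weights

_↾_ : ∀ {m} → (Fin m → ℕ) → Subset m → Fin m → ℕ
(g ↾ A) i = if does (i ∈? A) then g i else 0

module _ {m : ℕ} (g : Fin m → ℕ) where

  ↾-≤ : ∀ A i → (g ↾ A) i ≤ g i
  ↾-≤ A i with i ∈? A
  ... | yes _ = ℕP.≤-refl
  ... | no _  = z≤n

  ↾-∈ : ∀ {A i} → i ∈ A → (g ↾ A) i ≡ g i
  ↾-∈ {A} {i} i∈A = if-yes (i ∈? A) i∈A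

  ∣↾⊤∣f : ∣ g ↾ ⊤ ∣f ≡ ∣ g ∣f
  ∣↾⊤∣f = Σℕ-cong m (λ i → ↾-∈ ∈⊤)

  ∣↾∣f-empty : ∀ {A} → (∀ i → i ∉ A) → ∣ g ↾ A ∣f ≡ 0
  ∣↾∣f-empty {A} empty = Σℕ-zero m (λ i → if-no (i ∈? A) (empty i))

  ∣↾∣f-erase : ∀ {A e} → e ∈ A → ∣ g ↾ A ∣f ≡ g e ℕ.+ ∣ g ↾ (A - e) ∣f
  ∣↾∣f-erase {A} {e} e∈A = trans (Σℕ-erase m (g ↾ A) e) (cong₂ ℕ._+_ (↾-∈ e∈A) (Σℕ-cong m erase≗↾))
    where
    erase≗↾ : ∀ i → erase (g ↾ A) e i ≡ (g ↾ (A - e)) i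
    erase≗↾ i with i ≟ e
    ... | yes refl = sym (if-no (e ∈? (A - e)) (x∉p-x A e))
    ... | no i≢e with i ∈? A
    ...   | yes i∈A = sym (if-yes (i ∈? (A - e)) (x∈p∧x≢y⇒x∈p-y i∈A i≢e))
    ...   | no i∉A  = sym (if-no (i ∈? (A - e)) (i∉A ∘ x∈p-y⇒x∈p))

module Weighted {p q : ℕ} (es : List (Fin p × Fin q)) (f : Fin (length es) → ℕ) where
  open Matchings es

  weight : Subset (length es) → ℕ
  weight A = ∣ f ↾ A ∣f

  degB-↾-≤ : ∀ A b → degB es (f ↾ A) b ≤ degB es f b
  degB-↾-≤ A b = Σℕ-mono-≤ (length es) (λ i → term (does (endB i ≟ b)) i)
    where
    term : ∀ c i → (if c then (f ↾ A) i else 0) ≤ (if c then f i else 0)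
    term true  i = ↾-≤ f A i
    term false i = z≤n

  degC-↾-≤ : ∀ A c → degC es (f ↾ A) c ≤ degC es f c
  degC-↾-≤ A c = Σℕ-mono-≤ (length es) (λ i → term (does (endC i ≟ c)) i)
    where
    term : ∀ b i → (if b then (f ↾ A) i else 0) ≤ (if b then f i else 0)
    term true  i = ↾-≤ f A i
    term false i = z≤n

  private
    summandC : Subset (length es) → Fin q → Fin (length es) → ℕ
    summandC A c i = if does (endC i ≟ c) then (f ↾ A) i else 0

    summandC-∈ : ∀ {A c i} → i ∈ A → endC i ≡ c → summandC A c i ≡ f i
    summandC-∈ {A} {c} {i} i∈A i-at-c = trans (if-yes (endC i ≟ c) i-at-c) (↾-∈ f i∈A)

  degC-≥-pair : ∀ {A c i j} → i ∈ A → j ∈ A → i ≢ j → endC i ≡ c → endC j ≡ c →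
                f i ℕ.+ f j ≤ degC es (f ↾ A) c
  degC-≥-pair {A} {c} i∈A j∈A i≢j i-at-c j-at-c = subst₂ (λ a b → a ℕ.+ b ≤ degC es (f ↾ A) c)
    (summandC-∈ i∈A i-at-c) (summandC-∈ j∈A j-at-c) (Σℕ-≥-pair (length es) (summandC A c) i≢j)

  degC-≥-triple : ∀ {A c i j k} → i ∈ A → j ∈ A → k ∈ A → i ≢ j → i ≢ k → j ≢ k →
                  endC i ≡ c → endC j ≡ c → endC k ≡ c → f i ℕ.+ (f j ℕ.+ f k) ≤ degC es (f ↾ A) c
  degC-≥-triple {A} {c} i∈A j∈A k∈A i≢j i≢k j≢k i-at-c j-at-c k-at-c =
    subst₂ (λ a b → a ℕ.+ b ≤ degC es (f ↾ A) c) (summandC-∈ i∈A i-at-c)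
      (cong₂ ℕ._+_ (summandC-∈ j∈A j-at-c) (summandC-∈ k∈A k-at-c)) (Σℕ-≥-triple (length es) (summandC A c) i≢j i≢k j≢k)

  -- Every edge meeting e lies in A ─ meeting e, or shares the B-end or the C-end of e;
  -- e itself shares both, which pays for the extra f e.
  weight-link : ∀ {A e} → e ∈ A →
    f e ℕ.+ weight A ≤ weight (A ─ meeting e) ℕ.+ degB es (f ↾ A) (endB e) ℕ.+ degC es (f ↾ A) (endC e)
  weight-link {A} {e} e∈A = subst₂ _≤_
    (trans (Σℕ-+ (length es) _ (f ↾ A))
           (cong (ℕ._+ weight A) (trans (Σℕ-single (length es) _ e (λ i → if-no (i ≟ e))) (if-yes (e ≟ e) refl))))
    (trans (Σℕ-+ (length es) _ _) (cong (ℕ._+ degC es (f ↾ A) (endC e)) (Σℕ-+ (length es) _ _)))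
    (Σℕ-mono-≤ (length es) pointwise)
    where
    pointwise : ∀ i → (if does (i ≟ e) then f i else 0) ℕ.+ (if does (i ∈? A) then f i else 0) ≤
                      (if does (i ∈? (A ─ meeting e)) then f i else 0)
                      ℕ.+ (if does (endB i ≟ endB e) then (if does (i ∈? A) then f i else 0) else 0)
                      ℕ.+ (if does (endC i ≟ endC e) then (if does (i ∈? A) then f i else 0) else 0)
    pointwise i with i ∈? A | i ≟ e | endB i ≟ endB e | endC i ≟ endC e | i ∈? (A ─ meeting e)
    ... | no i∉A  | yes refl | _     | _     | _      = ⊥-elim (i∉A e∈A)
    ... | no _    | no _     | _     | _     | _      = z≤n
    ... | yes _   | yes refl | _     | _     | yes e∈ = ⊥-elim (proj₂ (x∈p─q⁻ e∈) (e∈meeting e))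
    ... | yes _   | yes refl | yes _ | yes _ | no _   = ℕP.≤-refl
    ... | yes _   | yes refl | no ¬b | _     | no _   = ⊥-elim (¬b refl)
    ... | yes _   | yes refl | yes _ | no ¬c | no _   = ⊥-elim (¬c refl)
    ... | yes _   | no _     | _     | _     | yes _  = ℕP.≤-trans (ℕP.m≤m+n (f i) _) (ℕP.m≤m+n _ _)
    ... | yes _   | no _     | yes _ | _     | no _   = ℕP.m≤m+n (f i) _
    ... | yes _   | no _     | no _  | yes _ | no _   = ℕP.≤-refl
    ... | yes i∈A | no _     | no ¬b | no ¬c | no i∉  =
      ⊥-elim (i∉ (x∈p∧x∉q⇒x∈p─q i∈A ([ ¬b ∘ sym , ¬c ∘ sym ]′ ∘ ∈meeting⁻)))

  module Induction (t : ℕ) (degB≤t : ∀ b → degB es f b ≤ t) (degC≤2 : ∀ c → degC es f c ≤ 2) where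

    T : ℕ
    T = t ℕ.+ 2

    link-bound : ∀ {n X B e} → e ∈ B → X ≤ f e ℕ.+ weight B →
                 suc n ℕ.* T < X ℕ.+ T → n ℕ.* T < weight (B ─ meeting e) ℕ.+ T
    link-bound {n} {X} {B} {e} e∈B X≤ bound = ℕP.<-≤-trans n*T<X (ℕP.≤-trans X≤ loss)
      where
      n*T<X : n ℕ.* T < X
      n*T<X = ℕP.+-cancelˡ-< T _ _ (subst (T ℕ.+ n ℕ.* T <_) (ℕP.+-comm X T) bound)
      loss : f e ℕ.+ weight B ≤ weight (B ─ meeting e) ℕ.+ T
      loss = ℕP.≤-trans (weight-link e∈B) (ℕP.≤-trans
        (ℕP.+-mono-≤ (ℕP.+-monoʳ-≤ (weight (B ─ meeting e)) (ℕP.≤-trans (degB-↾-≤ B (endB e)) (degB≤t (endB e))))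
                     (ℕP.≤-trans (degC-↾-≤ B (endC e)) (degC≤2 (endC e))))
        (ℕP.≤-reflexive (ℕP.+-assoc (weight (B ─ meeting e)) t 2)))

    empty-light : ∀ {n A} → (∀ i → i ∉ A) → ¬ (suc n ℕ.* T < weight A ℕ.+ T)
    empty-light {n} empty bound =
      ℕP.m+n≮m T (n ℕ.* T) (subst (T ℕ.+ n ℕ.* T <_) (cong (ℕ._+ T) (∣↾∣f-empty f empty)) bound)

    AcyclicUpTo : ℕ → Set
    AcyclicUpTo N = ∀ A → ∣ A ∣ ≤ N → ∀ n → n ℕ.* T < weight A ℕ.+ T → Acyclic< (MatchingIn A) n

    module Step {N A} (IH : AcyclicUpTo N) (∣A∣≤1+N : ∣ A ∣ ≤ suc N) {n} (bound : suc n ℕ.* T < weight A ℕ.+ T) where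

      fuel : ∀ {x B} → x ∈ A → B ⊆ A - x → ∣ B ∣ ≤ N
      fuel x∈A B⊆A-x = ℕP.≤-pred (ℕP.<-≤-trans (p⊆q-x⇒∣p∣<∣q∣ x∈A B⊆A-x) ∣A∣≤1+N)

      link-acyclic : ∀ {B v} → B ⊆ A → v ∈ B → weight A ≤ f v ℕ.+ weight B → Acyclic< (MatchingIn (B ─ meeting v)) n
      link-acyclic {B} {v} B⊆A v∈B weight≤ =
        IH (B ─ meeting v) (fuel (B⊆A v∈B) (p─meeting-e⊆q-e B⊆A))
           n (link-bound {n} v∈B weight≤ bound)

      zero-edge : ∀ {e} → e ∈ A → f e ≡ 0 → Acyclic< (MatchingIn A) (suc n)
      zero-edge {e} e∈A fe≡0 = Acyclic<-MatchingIn e∈A n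
        (IH (A - e) (fuel e∈A id) (suc n)
          (subst (λ w → suc n ℕ.* T < w ℕ.+ T) (trans (∣↾∣f-erase f e∈A) (cong (ℕ._+ weight (A - e)) fe≡0)) bound))
        (link-acyclic id e∈A (ℕP.m≤n+m _ _))

      pendant-edge : ∀ {e} → e ∈ A → (∀ {j} → j ∈ A → endC j ≡ endC e → j ≡ e) → Acyclic< (MatchingIn A) (suc n)
      pendant-edge e∈A pendant = pendant⇒Acyclic< (suc N) ∣A∣≤1+N e∈A pendant n
        (λ v∈A _ _ → link-acyclic id v∈A (ℕP.m≤n+m _ _))

      -- Both edges at the C-end have weight 1; deleting e₁ loses weight 1, which the
      -- positive weight of the edge v whose link is taken makes up for.
      shared-end : ∀ {e₁ e₂} → (∀ {e} → e ∈ A → 1 ≤ f e) → e₁ ∈ A → e₂ ∈ A → e₂ ≢ e₁ → endC e₂ ≡ endC e₁ →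
                   Acyclic< (MatchingIn A) (suc n)
      shared-end {e₁} {e₂} positive e₁∈A e₂∈A e₂≢e₁ same-c = Acyclic<-MatchingIn e₁∈A n
        (pendant⇒Acyclic< N (fuel e₁∈A id) (x∈p∧x≢y⇒x∈p-y e₂∈A e₂≢e₁) e₂-pendant n
          (λ v∈ _ _ → link-acyclic x∈p-y⇒x∈p v∈ (weight≤ (x∈p-y⇒x∈p v∈))))
        (link-acyclic id e₁∈A (ℕP.m≤n+m _ _))
        where
        degC≤2ᴬ : degC es (f ↾ A) (endC e₁) ≤ 2
        degC≤2ᴬ = ℕP.≤-trans (degC-↾-≤ A (endC e₁)) (degC≤2 (endC e₁))
        fe₁≤1 : f e₁ ≤ 1
        fe₁≤1 = ℕP.+-cancelʳ-≤ 1 (f e₁) 1 (ℕP.≤-trans (ℕP.+-monoʳ-≤ (f e₁) (positive e₂∈A))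
                  (ℕP.≤-trans (degC-≥-pair e₁∈A e₂∈A (e₂≢e₁ ∘ sym) refl same-c) degC≤2ᴬ))
        weight≤ : ∀ {v} → v ∈ A → weight A ≤ f v ℕ.+ weight (A - e₁)
        weight≤ {v} v∈A = subst (_≤ f v ℕ.+ weight (A - e₁)) (sym (∣↾∣f-erase f e₁∈A))
          (ℕP.+-monoˡ-≤ (weight (A - e₁)) (ℕP.≤-trans fe₁≤1 (positive v∈A)))
        e₂-pendant : ∀ {j} → j ∈ A - e₁ → endC j ≡ endC e₂ → j ≡ e₂
        e₂-pendant {j} j∈ j-at-c with j ≟ e₂
        ... | yes j≡e₂ = j≡e₂
        ... | no j≢e₂  = ⊥-elim (ℕP.<⇒≱ (ℕP.≤-trans three≤ (degC-≥-triple (x∈p-y⇒x∈p j∈) e₁∈A e₂∈A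
                           (x∈p-y⇒x≢y j∈) j≢e₂ (e₂≢e₁ ∘ sym) (trans j-at-c same-c) refl same-c)) degC≤2ᴬ)
          where
          three≤ : 3 ≤ f j ℕ.+ (f e₁ ℕ.+ f e₂)
          three≤ = ℕP.+-mono-≤ (positive (x∈p-y⇒x∈p j∈)) (ℕP.+-mono-≤ (positive e₁∈A) (positive e₂∈A))

    ¬∃⇒unique : ∀ {A e} → ¬ (Σ[ j ∈ Fin (length es) ] (j ∈ A × endC j ≡ endC e × j ≢ e)) →
                ∀ {j} → j ∈ A → endC j ≡ endC e → j ≡ e
    ¬∃⇒unique {e = e} none {j} j∈A j-at-c with j ≟ e
    ... | yes j≡e = j≡e
    ... | no j≢e  = ⊥-elim (none (j , j∈A , j-at-c , j≢e))

    acyclicUpTo : ∀ N → AcyclicUpTo N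
    acyclicUpTo N       A ∣A∣≤N   zero    bound = λ _ ()
    acyclicUpTo zero    A ∣A∣≤0   (suc n) bound = ⊥-elim (empty-light {n} {A} (λ i → ∣p∣≤0⇒x∉p ∣A∣≤0) bound)
    acyclicUpTo (suc N) A ∣A∣≤1+N (suc n) bound
      with any? (λ e → e ∈? A ×-dec (f e ℕP.≟ 0))
         | any? (λ e → e ∈? A ×-dec ¬? (any? (λ j → j ∈? A ×-dec (endC j ≟ endC e) ×-dec ¬? (j ≟ e))))
         | any? (_∈? A)
    ... | yes (e , e∈A , fe≡0) | _ | _ = zero-edge e∈A fe≡0
      where open Step (acyclicUpTo N) ∣A∣≤1+N {n} bound
    ... | no _ | yes (e , e∈A , no-other) | _ = pendant-edge e∈A (¬∃⇒unique no-other)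
      where open Step (acyclicUpTo N) ∣A∣≤1+N {n} bound
    ... | no _ | no _ | no empty = ⊥-elim (empty-light {n} {A} (λ i i∈A → empty (i , i∈A)) bound)
    ... | no no-zero | no no-pendant | yes (e₁ , e₁∈A)
      with any? (λ j → j ∈? A ×-dec (endC j ≟ endC e₁) ×-dec ¬? (j ≟ e₁))
    ...   | no alone = ⊥-elim (no-pendant (e₁ , e₁∈A , alone))
    ...   | yes (e₂ , e₂∈A , same-c , e₂≢e₁) = shared-end positive e₁∈A e₂∈A e₂≢e₁ same-c
      where
      open Step (acyclicUpTo N) ∣A∣≤1+N {n} bound
      positive : ∀ {e} → e ∈ A → 1 ≤ f e
      positive e∈A = ℕP.n≢0⇒n>0 (λ fe≡0 → no-zero (_ , e∈A , fe≡0))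

-- Arithmetic of the bound

ℕ→ℚ≡mkℚ : ∀ n → ℕ→ℚ n ≡ mkℚ (ℤ.+ n) 0 (Coprime.sym (Coprime.1-coprimeTo n))
ℕ→ℚ≡mkℚ n = ℚP.normalize-coprime (Coprime.sym (Coprime.1-coprimeTo n))

ℕ→ℚ-+ : ∀ a b → ℕ→ℚ (a ℕ.+ b) ≡ ℕ→ℚ a + ℕ→ℚ b
ℕ→ℚ-+ a b = trans (cong (ℚ._/ 1) (trans (ℤP.pos-+ a b)
                                         (sym (cong₂ ℤ._+_ (ℤP.*-identityʳ (ℤ.+ a)) (ℤP.*-identityʳ (ℤ.+ b))))))
                  (sym (cong₂ _+_ (ℕ→ℚ≡mkℚ a) (ℕ→ℚ≡mkℚ b)))

ℕ→ℚ-* : ∀ a b → ℕ→ℚ (a ℕ.* b) ≡ ℕ→ℚ a * ℕ→ℚ b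
ℕ→ℚ-* a b = trans (cong (ℚ._/ 1) (ℤP.pos-* a b)) (sym (cong₂ _*_ (ℕ→ℚ≡mkℚ a) (ℕ→ℚ≡mkℚ b)))

ℕ→ℚ-<⁻¹ : ∀ {a b} → ℕ→ℚ a ℚ.< ℕ→ℚ b → a < b
ℕ→ℚ-<⁻¹ {a} {b} a<b with subst₂ ℚ._<_ (ℕ→ℚ≡mkℚ a) (ℕ→ℚ≡mkℚ b) a<b
... | ℚ.*<* a*1<b*1 with subst₂ ℤ._<_ (ℤP.*-identityʳ (ℤ.+ a)) (ℤP.*-identityʳ (ℤ.+ b)) a*1<b*1
... | ℤ.+<+ a<b = a<b

ℕ→ℚ-nonNeg : ∀ a → ℚ.NonNegative (ℕ→ℚ a)
ℕ→ℚ-nonNeg a = ℚP.normalize-nonNeg a 1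

⌈⌉≡-⌊-⌋ : (x : ℚ) → ℚ.⌈ x ⌉ ≡ ℤ.- ((ℤ.- ℚ.↥ x) ℤ./ (ℤ.+ suc (ℚ.denominator-1 x)))
⌈⌉≡-⌊-⌋ (mkℚ ℤ.-[1+ k ]   _ _) = refl
⌈⌉≡-⌊-⌋ (mkℚ (ℤ.+ zero)    _ _) = refl
⌈⌉≡-⌊-⌋ (mkℚ (ℤ.+ suc k)   _ _) = refl

-- With x = n / P and -n = r + k P (0 ≤ r < P), ⌈ x ⌉ = - k, and d + 1 ≤ - k gives d P < n.
ℕ→ℚ<x : (x : ℚ) (d : ℕ) → ℤ.+ d ℤ.≤ ℚ.⌈ x ⌉ ℤ.- ℤ.1ℤ → ℕ→ℚ d ℚ.< x
ℕ→ℚ<x x@(mkℚ n P-1 _) d d≤⌈x⌉-1 = subst (ℚ._< x) (sym (ℕ→ℚ≡mkℚ d)) (ℚ.*<* dP<n)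
  where
  P k r : ℤ
  P = ℤ.+ suc P-1
  k = (ℤ.- n) ℤ./ P
  r = ℤ.+ ((ℤ.- n) ℤ.% P)
  -n≡r+kP : ℤ.- n ≡ r ℤ.+ k ℤ.* P
  -n≡r+kP = ℤD.a≡a%n+[a/n]*n (ℤ.- n) P
  k+1≤-d : k ℤ.+ ℤ.1ℤ ℤ.≤ ℤ.- (ℤ.+ d)
  k+1≤-d = subst (ℤ._≤ ℤ.- (ℤ.+ d)) (lemma k)
             (ℤP.neg-mono-≤ (subst (λ c → ℤ.+ d ℤ.≤ c ℤ.- ℤ.1ℤ) (⌈⌉≡-⌊-⌋ x) d≤⌈x⌉-1))
    where
    lemma : ∀ y → ℤ.- (ℤ.- y ℤ.- ℤ.1ℤ) ≡ y ℤ.+ ℤ.1ℤ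
    lemma = ℤ-Solver.solve-∀
  -n<[k+1]P : ℤ.- n ℤ.< (k ℤ.+ ℤ.1ℤ) ℤ.* P
  -n<[k+1]P = subst₂ ℤ._<_ (sym -n≡r+kP) (lemma k P) (ℤP.+-monoˡ-< (k ℤ.* P) (ℤ.+<+ (ℤD.n%d<d (ℤ.- n) P)))
    where
    lemma : ∀ y z → z ℤ.+ y ℤ.* z ≡ (y ℤ.+ ℤ.1ℤ) ℤ.* z
    lemma = ℤ-Solver.solve-∀
  -n<-dP : ℤ.- n ℤ.< ℤ.- (ℤ.+ d ℤ.* P)
  -n<-dP = subst (ℤ.- n ℤ.<_) (lemma (ℤ.+ d) P) (ℤP.<-≤-trans -n<[k+1]P (ℤP.*-monoʳ-≤-nonNeg P k+1≤-d))
    where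
    lemma : ∀ y z → ℤ.- y ℤ.* z ≡ ℤ.- (y ℤ.* z)
    lemma = ℤ-Solver.solve-∀
  dP<n : ℤ.+ d ℤ.* P ℤ.< n ℤ.* ℤ.+ 1
  dP<n = subst (ℤ.+ d ℤ.* P ℤ.<_) (sym (ℤP.*-identityʳ n)) (ℤP.neg-cancel-< -n<-dP)

module _ (s : ℚ) (1≤s : 1ℚ ℚ.≤ s) where

  private
    instance
      s-pos : ℚ.Positive s
      s-pos = ℚ.positive (ℚP.<-≤-trans (ℚP.positive⁻¹ 1ℚ) 1≤s)
      2s-pos : ℚ.Positive (2ℚ * s)
      2s-pos = ℚP.pos*pos⇒pos 2ℚ s
      2s+2-pos : ℚ.Positive (2ℚ * s + 2ℚ)
      2s+2-pos = ℚP.pos+pos⇒pos (2ℚ * s) 2ℚ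
      2s+2-nonZero : ℚ.NonZero (2ℚ * s + 2ℚ)
      2s+2-nonZero = ℚP.pos⇒nonZero (2ℚ * s + 2ℚ)

  0≤2s : 0ℚ ℚ.≤ 2ℚ * s
  0≤2s = ℚP.<⇒≤ (ℚP.positive⁻¹ (2ℚ * s))

  ceilDiv-bound : ∀ {a d t} → ℕ→ℚ t ℚ.≤ 2ℚ * s → ℤ.+ d ℤ.≤ ceilDiv a s 1≤s ℤ.- ℤ.1ℤ → d ℕ.* (t ℕ.+ 2) < a
  ceilDiv-bound {a} {d} {t} t≤2s d≤ceil-1 = ℕ→ℚ-<⁻¹ (ℚP.≤-<-trans d[t+2]≤dD dD<a)
    where
    D = 2ℚ * s + 2ℚ
    dD<a : ℕ→ℚ d * D ℚ.< ℕ→ℚ a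
    dD<a = subst (ℕ→ℚ d * D ℚ.<_) a÷D*D≡a (ℚP.*-monoˡ-<-pos D (ℕ→ℚ<x (ℕ→ℚ a ℚ.÷ D) d d≤ceil-1))
      where
      a÷D*D≡a : (ℕ→ℚ a ℚ.÷ D) * D ≡ ℕ→ℚ a
      a÷D*D≡a = trans (ℚP.*-assoc (ℕ→ℚ a) (ℚ.1/ D) D)
                      (trans (cong (ℕ→ℚ a *_) (ℚP.*-inverseˡ D)) (ℚP.*-identityʳ (ℕ→ℚ a)))
    d[t+2]≤dD : ℕ→ℚ (d ℕ.* (t ℕ.+ 2)) ℚ.≤ ℕ→ℚ d * D
    d[t+2]≤dD = subst (ℚ._≤ ℕ→ℚ d * D) (sym (trans (ℕ→ℚ-* d (t ℕ.+ 2)) (cong (ℕ→ℚ d *_) (ℕ→ℚ-+ t 2))))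
                  (ℚP.*-monoˡ-≤-nonNeg (ℕ→ℚ d) {{ℕ→ℚ-nonNeg d}} (ℚP.+-monoˡ-≤ 2ℚ t≤2s))

maxFin : ∀ {k} → (Fin k → ℕ) → ℕ
maxFin {zero}  g = 0
maxFin {suc k} g = g zero ℕ.⊔ maxFin (g ∘ suc)

≤-maxFin : ∀ {k} (g : Fin k → ℕ) i → g i ≤ maxFin g
≤-maxFin g zero    = ℕP.m≤m⊔n _ _
≤-maxFin g (suc i) = ℕP.≤-trans (≤-maxFin (g ∘ suc) i) (ℕP.m≤n⊔m (g zero) _)

maxFin-preserves : ∀ {k} (P : ℕ → Set) → P 0 → (g : Fin k → ℕ) → (∀ i → P (g i)) → P (maxFin g)
maxFin-preserves {zero}  P P0 g Pg = P0
maxFin-preserves {suc k} P P0 g Pg with ℕP.⊔-sel (g zero) (maxFin (g ∘ suc))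
... | inj₁ max≡g0 = subst P (sym max≡g0) (Pg zero)
... | inj₂ max≡rest = subst P (sym max≡rest) (maxFin-preserves P P0 (g ∘ suc) (Pg ∘ suc))

lemma4p4 : (p q : ℕ) (es : List (Fin p × Fin q)) → Unique es →
    (s : ℚ) (hs : 1ℚ ℚ.≤ s) (f : Fin (length es) → ℕ) →
    (∀ e → f e ≤ 2) →
    (∀ b → ℕ→ℚ (degB es f b) ℚ.≤ 2ℚ ℚ.* s) →
    (∀ c → degC es f c ≤ 2) →
    η≥ (IsMatching es) (ceilDiv ∣ f ∣f s hs)
lemma4p4 p q es _ s hs f _ degB≤2s degC≤2 d d≤ceil-1 =
  HomologyVanishes-cong (λ σ → mk⇔ proj₁ (_, λ {_} _ → ∈⊤))
    (acyclicUpTo (length es) ⊤ (∣p∣≤n ⊤) (suc d) bound d (ℕP.n<1+n d))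
  where
  t : ℕ
  t = maxFin (degB es f)
  t≤2s : ℕ→ℚ t ℚ.≤ 2ℚ * s
  t≤2s = maxFin-preserves (λ x → ℕ→ℚ x ℚ.≤ 2ℚ * s) (0≤2s s hs) (degB es f) degB≤2s
  open Matchings es
  open Weighted es f
  open Induction t (≤-maxFin (degB es f)) degC≤2
  bound : suc d ℕ.* T < weight ⊤ ℕ.+ T
  bound = subst (λ w → suc d ℕ.* T < w ℕ.+ T) (sym (∣↾⊤∣f f))
            (subst (T ℕ.+ d ℕ.* T <_) (ℕP.+-comm T ∣ f ∣f) (ℕP.+-monoʳ-< T (ceilDiv-bound s hs t≤2s d≤ceil-1)))
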